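{- Let $n\ge1$, let $A=(\mathbf a_1,\dots,\mathbf a_n)$ be a real $n\times n$ matrix with columns $\mathbf a_1,\dots,\mathbf a_n$, and let $\sigma\in D_n$. Then $$\operatorname{dih}(\mathbf a_{\sigma(1)},\dots,\mathbf a_{\sigma(n)})=\operatorname{sig}(\sigma)\operatorname{dih}(A).$$
   Context: For $n\ge1$ and $k=1,\dots,n$, let $\rho_k$ be the permutation of $\{1,\dots,n\}$ with $\rho_k(1)=k,\rho_k(2)=k+1,\dots,\rho_k(n-k+1)=n,\rho_k(n-k+2)=1,\dots,\rho_k(n)=k-1$ (the "rotations"), and let $\mu_k$ be the permutation with $\mu_k(1)=k,\mu_k(2)=k-1,\dots,\mu_k(k)=1,\mu_k(k+1)=n,\mu_k(k+2)=n-1,\dots,\mu_k(n)=k+1$ (the "reflections"). The set $D_n=\{\rho_k,\mu_k: k=1,\dots,n\}$ is the dihedral group. Define $\operatorname{sig}(\rho_k)=1$ and $\operatorname{sig}(\mu_k)=-1$. For an $n\times n$ matrix $A=(a_{i,j})$, the dihedrant is $$\operatorname{dih}(A)=\sum_{k=1}^n\prod_{i=1}^n a_{i,\rho_k(i)}-\sum_{k=1}^n\prod_{i=1}^n a_{i,\mu_k(i)}.$$ -}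

module Defs where

open import Level using (Level)
open import Algebra.Bundles using (CommutativeRing)
open import Data.Nat using (ℕ; zero; suc)
import Data.Nat as N
open import Data.Nat.DivMod using (m%n<n)
open import Data.Fin using (Fin; toℕ; fromℕ<)
import Data.Fin as F

-- Indices are 0-based: Fin n = {0,…,n-1} stands for {1,…,n}.
-- The paper's ρ_k, μ_k (k = 1,…,n) correspond here to rot k', ref k'
-- with k' = k - 1 : Fin n, and
--   ρ_k(i) = k + i - 1 (mod n)       ⇝ rot k' i' = (k' + i') mod n
--   μ_k(i) = k + 1 - i (mod n)       ⇝ ref k' i' = (k' - i') mod n
-- where i' = i - 1.  We only use n = suc m (n ≥ 1).

data Dih (m : ℕ) : Set where
  rot : Fin (suc m) → Dih m
  ref : Fin (suc m) → Dih m

modFin : (m : ℕ) → ℕ → Fin (suc m)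
modFin m x = fromℕ< (m%n<n x (suc m))

ρ : {m : ℕ} → Fin (suc m) → Fin (suc m) → Fin (suc m)
ρ {m} k i = modFin m (toℕ k N.+ toℕ i)

-- (k' - i') mod n, computed as (k' + n - i') mod n
μ : {m : ℕ} → Fin (suc m) → Fin (suc m) → Fin (suc m)
μ {m} k i = modFin m (toℕ k N.+ (suc m N.∸ toℕ i))

perm : {m : ℕ} → Dih m → Fin (suc m) → Fin (suc m)
perm (rot k) = ρ k
perm (ref k) = μ k

module _ {c ℓ : Level} (R : CommutativeRing c ℓ) where
  open CommutativeRing R

  ∑ : {n : ℕ} → (Fin n → Carrier) → Carrier
  ∑ {zero} f = 0#
  ∑ {suc n} f = f F.zero + ∑ (λ i → f (F.suc i))

  ∏ : {n : ℕ} → (Fin n → Carrier) → Carrier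
  ∏ {zero} f = 1#
  ∏ {suc n} f = f F.zero * ∏ (λ i → f (F.suc i))

  sig : {m : ℕ} → Dih m → Carrier
  sig (rot _) = 1#
  sig (ref _) = - 1#

  -- the dihedrant of an n×n matrix A, A i j = a_{i,j} (row i, column j)
  dih : {m : ℕ} → (Fin (suc m) → Fin (suc m) → Carrier) → Carrier
  dih A = ∑ (λ k → ∏ (λ i → A i (ρ k i))) - ∑ (λ k → ∏ (λ i → A i (μ k i)))

  permuteColumns : {m : ℕ} → Dih m → (Fin (suc m) → Fin (suc m) → Carrier)
                 → (Fin (suc m) → Fin (suc m) → Carrier)
  permuteColumns σ A i j = A i (perm σ j)

module Submission where

-- Write n = suc m and read ρ k and μ k as the maps
-- i ↦ k + i and i ↦ k - i of ℤ/n.  In that reading the dihedral group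
-- multiplies by
--     ρ a ∘ ρ k = ρ (a + k),   ρ a ∘ μ k = μ (a + k),
--     μ a ∘ ρ k = μ (a - k),   μ a ∘ μ k = ρ (a - k),
-- and every ρ a, μ a is a bijection of Fin n.  Permuting the columns of A
-- by σ therefore turns the k-th summand of each half of dih A into the
-- (σ k)-th summand of the same half (σ a rotation) or of the other half
-- (σ a reflection); reindexing the sums over k along the bijection σ gives
-- dih (Aσ) = dih A resp. dih (Aσ) = - dih A.

open import Defs
open import Level using (Level)
open import Data.Nat using (ℕ; zero; suc)
open import Data.Fin using (Fin; toℕ)
import Data.Fin as F
open import Data.Fin.Properties using (toℕ-fromℕ<; toℕ-injective; toℕ<n)
open import Data.Fin.Permutation using (Permutation′; permutation; _⟨$⟩ʳ_)
open import Algebra.Bundles using (CommutativeRing)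
import Algebra.Properties.Monoid.Sum as MonoidSum
import Algebra.Properties.CommutativeMonoid.Sum as CommutativeMonoidSum
import Algebra.Properties.Ring as RingProperties
import Algebra.Properties.AbelianGroup as AbelianGroupProperties
open import Relation.Binary.Bundles using (Setoid)
open import Relation.Binary.PropositionalEquality using (_≡_; refl; sym; trans; cong; cong₂)
import Relation.Binary.Reasoning.Setoid as SetoidReasoning

module Modular (m : ℕ) where
  open import Data.Nat using (_+_; _∸_; _%_)
  open import Data.Nat.Properties using (+-assoc; +-comm; m+[n∸m]≡n; <⇒≤)
  open import Data.Nat.DivMod using (m%n%n≡m%n; [m+n]%n≡m%n; %-distribˡ-+; m%n<n; m<n⇒m%n≡m)

  n : ℕ
  n = suc m

  -- congruence modulo n; a record, so that both sides can be inferred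
  record _≋_ (x y : ℕ) : Set where
    constructor mod-eq
    field same-remainder : x % n ≡ y % n
  open _≋_

  infix 4 _≋_

  ≋-setoid : Setoid _ _
  ≋-setoid = record
    { Carrier       = ℕ
    ; _≈_           = _≋_
    ; isEquivalence = record
      { refl  = mod-eq refl
      ; sym   = λ p → mod-eq (sym (same-remainder p))
      ; trans = λ p q → mod-eq (trans (same-remainder p) (same-remainder q))
      }
    }

  open Setoid ≋-setoid using () renaming (refl to ≋-refl; sym to ≋-sym; trans to ≋-trans)
  open SetoidReasoning ≋-setoid

  ≡⇒≋ : ∀ {x y} → x ≡ y → x ≋ y
  ≡⇒≋ p = mod-eq (cong (_% n) p)

  ≋-+ : ∀ {x x′ y y′} → x ≋ x′ → y ≋ y′ → x + y ≋ x′ + y′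
  ≋-+ {x} {x′} {y} {y′} (mod-eq p) (mod-eq q) = mod-eq
    (trans (%-distribˡ-+ x y n)
      (trans (cong₂ (λ u v → (u + v) % n) p q) (sym (%-distribˡ-+ x′ y′ n))))

  %-≋ : ∀ x → x % n ≋ x
  %-≋ x = mod-eq (m%n%n≡m%n x n)

  +n-≋ : ∀ x → x + n ≋ x
  +n-≋ x = mod-eq ([m+n]%n≡m%n x n)

  +-inverse-≋ : ∀ t → t + (n ∸ t % n) ≋ n
  +-inverse-≋ t = begin
    t + (n ∸ t % n)       ≈⟨ ≋-+ (%-≋ t) ≋-refl ⟨
    t % n + (n ∸ t % n)   ≡⟨ m+[n∸m]≡n (<⇒≤ (m%n<n t n)) ⟩
    n                     ∎

  ≋-cancelʳ : ∀ {x y} t → x + t ≋ y + t → x ≋ y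
  ≋-cancelʳ {x} {y} t p = begin
    x                       ≈⟨ +n-≋ x ⟨
    x + n                   ≈⟨ ≋-+ ≋-refl (+-inverse-≋ t) ⟨
    x + (t + u)             ≡⟨ +-assoc x t u ⟨
    x + t + u               ≈⟨ ≋-+ p ≋-refl ⟩
    y + t + u               ≡⟨ +-assoc y t u ⟩
    y + (t + u)             ≈⟨ ≋-+ ≋-refl (+-inverse-≋ t) ⟩
    y + n                   ≈⟨ +n-≋ y ⟩
    y                       ∎
    where u = n ∸ t % n

  Fin-≋⇒≡ : {i j : Fin n} → toℕ i ≋ toℕ j → i ≡ j
  Fin-≋⇒≡ {i} {j} (mod-eq p) = toℕ-injective
    (trans (sym (m<n⇒m%n≡m (toℕ<n i))) (trans p (m<n⇒m%n≡m (toℕ<n j))))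

  toℕ-modFin : ∀ x → toℕ (modFin m x) ≋ x
  toℕ-modFin x = ≋-trans (≡⇒≋ (toℕ-fromℕ< (m%n<n x n))) (%-≋ x)

  ρ-spec : (k i : Fin n) → toℕ (ρ k i) ≋ toℕ k + toℕ i
  ρ-spec k i = toℕ-modFin (toℕ k + toℕ i)

  μ-spec : (k i : Fin n) → toℕ (μ k i) + toℕ i ≋ toℕ k
  μ-spec k i = begin
    toℕ (μ k i) + I                ≈⟨ ≋-+ (toℕ-modFin (toℕ k + (n ∸ I))) ≋-refl ⟩
    toℕ k + (n ∸ I) + I            ≡⟨ +-assoc (toℕ k) (n ∸ I) I ⟩
    toℕ k + (n ∸ I + I)            ≡⟨ cong (toℕ k +_) (trans (+-comm (n ∸ I) I) (m+[n∸m]≡n (<⇒≤ (toℕ<n i)))) ⟩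
    toℕ k + n                      ≈⟨ +n-≋ (toℕ k) ⟩
    toℕ k                          ∎
    where I = toℕ i

  ρ-unique : {j : Fin n} (k i : Fin n) → toℕ j ≋ toℕ k + toℕ i → j ≡ ρ k i
  ρ-unique k i p = Fin-≋⇒≡ (≋-trans p (≋-sym (ρ-spec k i)))

  μ-unique : {j : Fin n} (k i : Fin n) → toℕ j + toℕ i ≋ toℕ k → j ≡ μ k i
  μ-unique k i p = Fin-≋⇒≡ (≋-cancelʳ (toℕ i) (≋-trans p (≋-sym (μ-spec k i))))

  ρ∘ρ : (a k i : Fin n) → ρ a (ρ k i) ≡ ρ (ρ a k) i
  ρ∘ρ a k i = ρ-unique (ρ a k) i (begin
    toℕ (ρ a (ρ k i))              ≈⟨ ρ-spec a (ρ k i) ⟩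
    toℕ a + toℕ (ρ k i)            ≈⟨ ≋-+ ≋-refl (ρ-spec k i) ⟩
    toℕ a + (toℕ k + toℕ i)        ≡⟨ +-assoc (toℕ a) (toℕ k) (toℕ i) ⟨
    toℕ a + toℕ k + toℕ i          ≈⟨ ≋-+ (ρ-spec a k) ≋-refl ⟨
    toℕ (ρ a k) + toℕ i            ∎)

  ρ∘μ : (a k i : Fin n) → ρ a (μ k i) ≡ μ (ρ a k) i
  ρ∘μ a k i = μ-unique (ρ a k) i (begin
    toℕ (ρ a (μ k i)) + toℕ i      ≈⟨ ≋-+ (ρ-spec a (μ k i)) ≋-refl ⟩
    toℕ a + toℕ (μ k i) + toℕ i    ≡⟨ +-assoc (toℕ a) (toℕ (μ k i)) (toℕ i) ⟩
    toℕ a + (toℕ (μ k i) + toℕ i)  ≈⟨ ≋-+ ≋-refl (μ-spec k i) ⟩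
    toℕ a + toℕ k                  ≈⟨ ρ-spec a k ⟨
    toℕ (ρ a k)                    ∎)

  μ∘ρ : (a k i : Fin n) → μ a (ρ k i) ≡ μ (μ a k) i
  μ∘ρ a k i = μ-unique (μ a k) i (≋-cancelʳ (toℕ k) (begin
    toℕ (μ a (ρ k i)) + toℕ i + toℕ k    ≡⟨ +-assoc (toℕ (μ a (ρ k i))) (toℕ i) (toℕ k) ⟩
    toℕ (μ a (ρ k i)) + (toℕ i + toℕ k)  ≡⟨ cong (toℕ (μ a (ρ k i)) +_) (+-comm (toℕ i) (toℕ k)) ⟩
    toℕ (μ a (ρ k i)) + (toℕ k + toℕ i)  ≈⟨ ≋-+ ≋-refl (ρ-spec k i) ⟨
    toℕ (μ a (ρ k i)) + toℕ (ρ k i)      ≈⟨ μ-spec a (ρ k i) ⟩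
    toℕ a                                ≈⟨ μ-spec a k ⟨
    toℕ (μ a k) + toℕ k                  ∎))

  μ∘μ : (a k i : Fin n) → μ a (μ k i) ≡ ρ (μ a k) i
  μ∘μ a k i = ρ-unique (μ a k) i (≋-cancelʳ (toℕ k) (begin
    toℕ (μ a (μ k i)) + toℕ k                      ≈⟨ ≋-+ ≋-refl (μ-spec k i) ⟨
    toℕ (μ a (μ k i)) + (toℕ (μ k i) + toℕ i)      ≡⟨ +-assoc (toℕ (μ a (μ k i))) (toℕ (μ k i)) (toℕ i) ⟨
    toℕ (μ a (μ k i)) + toℕ (μ k i) + toℕ i        ≈⟨ ≋-+ (μ-spec a (μ k i)) ≋-refl ⟩
    toℕ a + toℕ i                                  ≈⟨ ≋-+ (μ-spec a k) ≋-refl ⟨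
    toℕ (μ a k) + toℕ k + toℕ i                    ≡⟨ +-assoc (toℕ (μ a k)) (toℕ k) (toℕ i) ⟩
    toℕ (μ a k) + (toℕ k + toℕ i)                  ≡⟨ cong (toℕ (μ a k) +_) (+-comm (toℕ k) (toℕ i)) ⟩
    toℕ (μ a k) + (toℕ i + toℕ k)                  ≡⟨ +-assoc (toℕ (μ a k)) (toℕ i) (toℕ k) ⟨
    toℕ (μ a k) + toℕ i + toℕ k                    ∎))

  ρ-permutation : Fin n → Permutation′ n
  ρ-permutation a = permutation (ρ a) (λ y → μ y a)
    (λ y → sym (ρ-unique a (μ y a) (≋-trans (≋-sym (μ-spec y a)) (≡⇒≋ (+-comm (toℕ (μ y a)) (toℕ a))))))
    (λ y → sym (μ-unique (ρ a y) a (≋-trans (≡⇒≋ (+-comm (toℕ y) (toℕ a))) (≋-sym (ρ-spec a y)))))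

  μ-involutive : (a y : Fin n) → μ a (μ a y) ≡ y
  μ-involutive a y = sym (μ-unique a (μ a y) (≋-trans (≡⇒≋ (+-comm (toℕ y) (toℕ (μ a y)))) (μ-spec a y)))

  μ-permutation : Fin n → Permutation′ n
  μ-permutation a = permutation (μ a) (μ a) (μ-involutive a) (μ-involutive a)

module Sums {c ℓ : Level} (R : CommutativeRing c ℓ) where
  open CommutativeRing R hiding (refl; sym; trans)
  open MonoidSum +-monoid using (sum; sum-cong-≗)
  open CommutativeMonoidSum +-commutativeMonoid using (sum-permute)
  open SetoidReasoning setoid

  ∑≡sum : ∀ {k} (f : Fin k → Carrier) → ∑ R f ≡ sum f
  ∑≡sum {zero}  f = refl
  ∑≡sum {suc k} f = cong (f F.zero +_) (∑≡sum (λ i → f (F.suc i)))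

  ∑-cong : ∀ {k} {f g : Fin k → Carrier} → (∀ i → f i ≡ g i) → ∑ R f ≡ ∑ R g
  ∑-cong {f = f} {g} f≗g = trans (∑≡sum f) (trans (sum-cong-≗ f≗g) (sym (∑≡sum g)))

  ∏-cong : ∀ {k} {f g : Fin k → Carrier} → (∀ i → f i ≡ g i) → ∏ R f ≡ ∏ R g
  ∏-cong {zero}  f≗g = refl
  ∏-cong {suc k} f≗g = cong₂ _*_ (f≗g F.zero) (∏-cong (λ i → f≗g (F.suc i)))

  ∑-permute : ∀ {k} (π : Permutation′ k) (h : Fin k → Carrier) →
              ∑ R (λ i → h (π ⟨$⟩ʳ i)) ≈ ∑ R h
  ∑-permute π h = begin
    ∑ R (λ i → h (π ⟨$⟩ʳ i))  ≡⟨ ∑≡sum (λ i → h (π ⟨$⟩ʳ i)) ⟩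
    sum (λ i → h (π ⟨$⟩ʳ i))  ≈⟨ sum-permute h π ⟨
    sum h                     ≡⟨ ∑≡sum h ⟨
    ∑ R h                     ∎

  difference-swap : ∀ x y → x - y ≈ - 1# * (y - x)
  difference-swap x y = begin
    x - y          ≈⟨ AbelianGroupProperties.⁻¹-anti-homo‿- +-abelianGroup y x ⟨
    - (y - x)      ≈⟨ RingProperties.-1*x≈-x ring (y - x) ⟨
    - 1# * (y - x) ∎

module Dihedrant {c ℓ : Level} (R : CommutativeRing c ℓ) (m : ℕ) where
  open CommutativeRing R
  open Modular m using (n)
  open Sums R using (∑-cong; ∏-cong; ∑-permute)
  open SetoidReasoning setoid

  Matrix : Set c
  Matrix = Fin n → Fin n → Carrier

  term : (Fin n → Fin n → Fin n) → Matrix → Fin n → Carrier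
  term π A k = ∏ R (λ i → A i (π k i))

  ∑-term-permuteColumns : (σ : Dih m) (π π′ : Fin n → Fin n → Fin n) (s : Permutation′ n)
    → (∀ k i → perm σ (π k i) ≡ π′ (s ⟨$⟩ʳ k) i)
    → (A : Matrix) → ∑ R (term π (permuteColumns R σ A)) ≈ ∑ R (term π′ A)
  ∑-term-permuteColumns σ π π′ s law A = begin
    ∑ R (term π (permuteColumns R σ A))     ≡⟨ ∑-cong (λ k → ∏-cong (λ i → cong (A i) (law k i))) ⟩
    ∑ R (λ k → term π′ A (s ⟨$⟩ʳ k))        ≈⟨ ∑-permute s (term π′ A) ⟩
    ∑ R (term π′ A)                         ∎

theorem2 : {c ℓ : Level} (R : CommutativeRing c ℓ) (m : ℕ)
    (A : Fin (suc m) → Fin (suc m) → CommutativeRing.Carrier R) (σ : Dih m) →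
    CommutativeRing._≈_ R (dih R (permuteColumns R σ A))
    (CommutativeRing._*_ R (sig R σ) (dih R A))
theorem2 R m A (rot a) = begin
    dih R (permuteColumns R (rot a) A)
      ≈⟨ +-cong (∑-term-permuteColumns (rot a) ρ ρ (ρ-permutation a) (ρ∘ρ a) A)
                (-‿cong (∑-term-permuteColumns (rot a) μ μ (ρ-permutation a) (ρ∘μ a) A)) ⟩
    dih R A
      ≈⟨ *-identityˡ (dih R A) ⟨
    1# * dih R A ∎
  where
  open CommutativeRing R
  open Modular m
  open Dihedrant R m
  open SetoidReasoning setoid
theorem2 R m A (ref a) = begin
    dih R (permuteColumns R (ref a) A)
      ≈⟨ +-cong (∑-term-permuteColumns (ref a) ρ μ (μ-permutation a) (μ∘ρ a) A)
                (-‿cong (∑-term-permuteColumns (ref a) μ ρ (μ-permutation a) (μ∘μ a) A)) ⟩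
    ∑ R (term μ A) - ∑ R (term ρ A)
      ≈⟨ difference-swap (∑ R (term μ A)) (∑ R (term ρ A)) ⟩
    - 1# * dih R A ∎
  where
  open CommutativeRing R
  open Modular m
  open Sums R using (difference-swap)
  open Dihedrant R m
  open SetoidReasoning setoid
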